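{- (Provably in $\mathrm{EA}$.) For every tree ordinal $t$ and every natural number $x\ge2$: $N(o(t[x]))\le N\big(o(t)[x+Cr(t)]\big)+x+Cr(t)-2$ and $o(t[x])\le o(t)[x+Cr(t)]$.
   Context: Tree ordinals: the set of formal terms given by $0$ and, for terms $t_1,\dots,t_n$ ($n\ge1$), the formal unnormalized sum $\omega^{t_1}+\dots+\omega^{t_n}$. Sum is concatenation of summands ($0$ neutral); $1:=\omega^0$; $t+1$ appends $\omega^0$; $t\cdot0=0$, $t\cdot(x+1)=t\cdot x+t$. A nonzero term is a successor if its last summand is $\omega^0$, otherwise a limit. Term fundamental sequences: $0[x]=0$, $(t+1)[x]=t$, $(t+\omega^{s+1})[x]=t+\omega^s\cdot x$, $(t+\omega^\lambda)[x]=t+\omega^{\lambda[x]}$ for limit $\lambda$ ($t$ may be $0$). Value $o(0)=0$, $o(\omega^{t_1}+\dots+\omega^{t_n})=\omega^{o(t_1)}+\dots+\omega^{o(t_n)}$ (ordinal arithmetic, an ordinal $<\varepsilon_0$); $t<s$ means $o(t)<o(s)$. Ordinal fundamental sequences below $\varepsilon_0$ (Cantor normal form): $0[x]=0$, $(\gamma+1)[x]=\gamma$, $(\gamma+\omega^{\delta+1})[x]=\gamma+\omega^\delta\cdot x$, $(\gamma+\omega^\lambda)[x]=\gamma+\omega^{\lambda[x]}$ for limit $\lambda$. Norm on ordinals $<\varepsilon_0$: $N0=0$, $N(\omega^\alpha+\beta)=1+N\alpha+N\beta$ where $\beta<\omega^{\alpha+1}$. Norm on terms: $N0=0$, $N(\omega^{t_1}+\dots+\omega^{t_n})=\sum_i(1+Nt_i)$.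 Correction: $Cr(0)=0$, $Cr(\omega^{t_1}+\dots+\omega^{t_n})=\sum\{N(\omega^{t_i}):t_i<t_j\text{ for some }j>i\}+\max\{Cr(t_i):i\le n\}$. -}

module Defs where

open import Data.Nat using (ℕ; zero; suc; _+_; _⊔_)
open import Data.List using (List; []; _∷_; replicate)
open import Data.Bool using (Bool; true; false; if_then_else_; _∨_)
open import Data.Sum using (_⊎_)
open import Relation.Binary.PropositionalEquality using (_≡_)

-- Tree ordinals (formal terms).
-- node []            represents 0
-- node (t₁ ∷ … ∷ tₙ)  represents the formal sum ω^{t₁} + … + ω^{tₙ}

data Tree : Set where
  node : List Tree → Tree

𝟘 : Tree
𝟘 = node []

-- Ordinals below ε₀ are represented by their Cantor normal form, i.e.
-- by trees whose summand lists are (recursively) non-increasing.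
-- The ordinal operations below are only meant to be applied to such
-- normal forms (every ordinal occurring in the statement is of the
-- form o(t) or a fundamental-sequence member of it, hence normal).

data Cmp : Set where
  lt eq gt : Cmp

mutual
  cmp : Tree → Tree → Cmp
  cmp (node as) (node bs) = cmpL as bs

  cmpL : List Tree → List Tree → Cmp
  cmpL []       []       = eq
  cmpL []       (_ ∷ _)  = lt
  cmpL (_ ∷ _)  []       = gt
  cmpL (a ∷ as) (b ∷ bs) with cmp a b
  ... | lt = lt
  ... | gt = gt
  ... | eq = cmpL as bs

infix 4 _<o_ _≤o_
_<o_ : Tree → Tree → Set
α <o β = cmp α β ≡ lt

_≤o_ : Tree → Tree → Set
α ≤o β = (cmp α β ≡ lt) ⊎ (cmp α β ≡ eq)

ωplus : Tree → List Tree → List Tree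
ωplus e []       = e ∷ []
ωplus e (b ∷ bs) with cmp e b
... | lt = b ∷ bs
... | _  = e ∷ b ∷ bs

mutual
  o : Tree → Tree
  o (node ts) = node (oL ts)

  oL : List Tree → List Tree
  oL []       = []
  oL (t ∷ ts) = ωplus (o t) (oL ts)

_<t_ : Tree → Tree → Set
t <t s = o t <o o s

_<t?_ : Tree → Tree → Bool
t <t? s with cmp (o t) (o s)
... | lt = true
... | _  = false

-- Fundamental sequences on terms:
--   0[x] = 0, (t+1)[x] = t, (t+ω^{s+1})[x] = t+ω^s·x,
--   (t+ω^λ)[x] = t+ω^{λ[x]} for limit λ.


isSucc : List Tree → Bool
isSucc []               = false
isSucc (node [] ∷ [])   = true
isSucc (node (_ ∷ _) ∷ []) = false
isSucc (_ ∷ a ∷ as)     = isSucc (a ∷ as)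

dropLast : List Tree → List Tree
dropLast []           = []
dropLast (_ ∷ [])     = []
dropLast (a ∷ b ∷ bs) = a ∷ dropLast (b ∷ bs)

mutual
  _[_] : Tree → ℕ → Tree
  node ts [ x ] = node (fsL ts x)

  fsL : List Tree → ℕ → List Tree
  fsL []             x = []
  fsL (s ∷ [])       x = fsLast s x
  fsL (s ∷ s' ∷ ss)  x = s ∷ fsL (s' ∷ ss) x

  fsLast : Tree → ℕ → List Tree
  fsLast (node [])       x = []
  fsLast (node (a ∷ as)) x =
    if isSucc (a ∷ as)
    then replicate x (node (dropLast (a ∷ as)))
    else (node (fsL (a ∷ as) x) ∷ [])

-- The
-- defining clauses are literally the same as for terms (γ+1 ↦ γ,
-- γ+ω^{δ+1} ↦ γ+ω^δ·x, γ+ω^λ ↦ γ+ω^{λ[x]}), where an exponent in CNF is a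
-- successor δ+1 iff its last summand is ω^0, with δ its CNF minus that
-- summand.
_[_]o : Tree → ℕ → Tree
α [ x ]o = α [ x ]

mutual
  Nt : Tree → ℕ
  Nt (node ts) = NtL ts

  NtL : List Tree → ℕ
  NtL []       = 0
  NtL (t ∷ ts) = suc (Nt t) + NtL ts

mutual
  No : Tree → ℕ
  No (node as) = NoL as

  NoL : List Tree → ℕ
  NoL []       = 0
  NoL (a ∷ as) = suc (No a) + NoL as

anyGreater : Tree → List Tree → Bool
anyGreater t []       = false
anyGreater t (s ∷ ss) = (t <t? s) ∨ anyGreater t ss

NωT : Tree → ℕ
NωT t = Nt (node (t ∷ []))

crSum : List Tree → ℕ
crSum []       = 0
crSum (t ∷ ts) = (if anyGreater t ts then NωT t else 0) + crSum ts

mutual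
  Cr : Tree → ℕ
  Cr (node ts) = crSum ts + crMax ts

  crMax : List Tree → ℕ
  crMax []       = 0
  crMax (t ∷ ts) = Cr t ⊔ crMax ts

module Submission where

-- Only the last summand ω^s of t changes in t[x]. For t = ω^s alone the claim holds for every
-- argument y ≥ x + Cr s in place of x + Cr t: it is immediate when s is 0 or a successor, and
-- when s is a limit it is the induction hypothesis for s combined with monotonicity of
-- fundamental sequences in their argument. The earlier summands are then put back in front one
-- at a time. A summand kept in o(t) is also kept in o(t[x]) and is added on both sides. A summand
-- ω^{tᵢ} absorbed in o(t), i.e. with tᵢ < tⱼ for some j > i, may survive in o(t[x]); then Cr t
-- contains N(ω^{tᵢ}), and raising the argument by that amount makes room for it by the Bachmann
-- property: β < λ and Nβ < y imply β < λ[y]. The norm bound grows by the same amount.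

open import Defs
open import Data.Bool using (true; false; if_then_else_)
open import Data.Bool.Properties using (∨-zeroʳ)
open import Data.Empty using (⊥; ⊥-elim)
open import Function using (case_of_)
open import Data.List using (List; []; _∷_; _++_; _∷ʳ_; replicate; initLast; _∷ʳ′_)
open import Data.List.Properties using (++-conicalʳ)
open import Data.List.Relation.Unary.All using (All; []; _∷_; head)
open import Data.List.Relation.Unary.All.Properties using (++⁻ʳ)
open import Data.Nat using (ℕ; zero; suc; _+_; _∸_; _≤_; _<_; _⊔_; z≤n; s≤s; z<s)
open import Data.Nat.Properties
open import Data.Nat.Tactic.RingSolver using (solve-∀)
open import Data.Product using (_×_; _,_; proj₁; proj₂; Σ-syntax)
open import Data.Sum using (_⊎_; inj₁; inj₂)
open import Data.Unit using (⊤; tt)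
open import Relation.Nullary using (¬_)
open import Relation.Binary.PropositionalEquality
  using (_≡_; _≢_; refl; sym; trans; cong; cong₂; subst)

-- Comparison of Cantor normal forms
invert : Cmp → Cmp
invert lt = gt
invert eq = eq
invert gt = lt

lexStep : Cmp → List Tree → List Tree → Cmp
lexStep lt _  _  = lt
lexStep eq as bs = cmpL as bs
lexStep gt _  _  = gt

cmpL-∷ : ∀ a b as bs → cmpL (a ∷ as) (b ∷ bs) ≡ lexStep (cmp a b) as bs
cmpL-∷ a b as bs with cmp a b
... | lt = refl
... | eq = refl
... | gt = refl

infix 4 _<L_ _≤L_
_<L_ : List Tree → List Tree → Set
as <L bs = node as <o node bs

_≤L_ : List Tree → List Tree → Set
as ≤L bs = node as ≤o node bs

mutual
  cmp-refl : ∀ a → cmp a a ≡ eq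
  cmp-refl (node as) = cmpL-refl as

  cmpL-refl : ∀ as → cmpL as as ≡ eq
  cmpL-refl []       = refl
  cmpL-refl (a ∷ as) rewrite cmpL-∷ a a as as | cmp-refl a = cmpL-refl as

mutual
  cmp≡eq⇒≡ : ∀ a b → cmp a b ≡ eq → a ≡ b
  cmp≡eq⇒≡ (node as) (node bs) p = cong node (cmpL≡eq⇒≡ as bs p)

  cmpL≡eq⇒≡ : ∀ as bs → cmpL as bs ≡ eq → as ≡ bs
  cmpL≡eq⇒≡ []       []       p = refl
  cmpL≡eq⇒≡ (a ∷ as) (b ∷ bs) p rewrite cmpL-∷ a b as bs with cmp a b in q
  cmpL≡eq⇒≡ (a ∷ as) (b ∷ bs) () | lt
  cmpL≡eq⇒≡ (a ∷ as) (b ∷ bs) p  | eq = cong₂ _∷_ (cmp≡eq⇒≡ a b q) (cmpL≡eq⇒≡ as bs p)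
  cmpL≡eq⇒≡ (a ∷ as) (b ∷ bs) () | gt

mutual
  cmp-swap : ∀ a b → cmp b a ≡ invert (cmp a b)
  cmp-swap (node as) (node bs) = cmpL-swap as bs

  cmpL-swap : ∀ as bs → cmpL bs as ≡ invert (cmpL as bs)
  cmpL-swap []       []       = refl
  cmpL-swap []       (_ ∷ _)  = refl
  cmpL-swap (_ ∷ _)  []       = refl
  cmpL-swap (a ∷ as) (b ∷ bs)
    rewrite cmpL-∷ a b as bs | cmpL-∷ b a bs as | cmp-swap a b with cmp a b
  ... | lt = refl
  ... | eq = cmpL-swap as bs
  ... | gt = refl

cmp≡gt⇒>o : ∀ a b → cmp a b ≡ gt → b <o a
cmp≡gt⇒>o a b p = trans (cmp-swap a b) (cong invert p)

∷-<L-cases : ∀ a b as bs → a ∷ as <L b ∷ bs → a <o b ⊎ (a ≡ b × as <L bs)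
∷-<L-cases a b as bs p rewrite cmpL-∷ a b as bs with cmp a b in q
... | lt = inj₁ refl
... | eq = inj₂ (cmp≡eq⇒≡ a b q , p)

mutual
  <o-trans : ∀ a b c → a <o b → b <o c → a <o c
  <o-trans (node as) (node bs) (node cs) = cmpL-trans as bs cs

  cmpL-trans : ∀ as bs cs → as <L bs → bs <L cs → as <L cs
  cmpL-trans []       _        (_ ∷ _)  _  _  = refl
  cmpL-trans []       []       []       _  ()
  cmpL-trans []       (_ ∷ _)  []       _  ()
  cmpL-trans (_ ∷ _)  []       _        () _
  cmpL-trans (_ ∷ _)  (_ ∷ _)  []       _  ()
  cmpL-trans (a ∷ as) (b ∷ bs) (c ∷ cs) p q
    rewrite cmpL-∷ a c as cs
    with ∷-<L-cases a b as bs p | ∷-<L-cases b c bs cs q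
  ... | inj₁ a<b          | inj₁ b<c          rewrite <o-trans a b c a<b b<c = refl
  ... | inj₁ a<b          | inj₂ (refl , _)   rewrite a<b = refl
  ... | inj₂ (refl , _)   | inj₁ b<c          rewrite b<c = refl
  ... | inj₂ (refl , as<bs) | inj₂ (refl , bs<cs) rewrite cmp-refl a =
    cmpL-trans as bs cs as<bs bs<cs

≤o-refl : ∀ a → a ≤o a
≤o-refl a = inj₂ (cmp-refl a)

≤o-<o-trans : ∀ a b c → a ≤o b → b <o c → a <o c
≤o-<o-trans a b c (inj₁ p) q = <o-trans a b c p q
≤o-<o-trans a b c (inj₂ p) q with cmp≡eq⇒≡ a b p
... | refl = q

<o-≤o-trans : ∀ a b c → a <o b → b ≤o c → a <o c
<o-≤o-trans a b c p (inj₁ q) = <o-trans a b c p q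
<o-≤o-trans a b c p (inj₂ q) with cmp≡eq⇒≡ b c q
... | refl = p

≤o-trans : ∀ a b c → a ≤o b → b ≤o c → a ≤o c
≤o-trans a b c p (inj₁ q) = inj₁ (≤o-<o-trans a b c p q)
≤o-trans a b c p (inj₂ q) with cmp≡eq⇒≡ b c q
... | refl = p

cmpL-∷-same : ∀ a as bs → cmpL (a ∷ as) (a ∷ bs) ≡ cmpL as bs
cmpL-∷-same a as bs rewrite cmpL-∷ a a as bs | cmp-refl a = refl

∷-<L : ∀ a b as bs → a <o b → a ∷ as <L b ∷ bs
∷-<L a b as bs p rewrite cmpL-∷ a b as bs | p = refl

∷-≤L : ∀ a as bs → as ≤L bs → a ∷ as ≤L a ∷ bs
∷-≤L a as bs p rewrite cmpL-∷-same a as bs = p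

∷-≤L⇒≤o : ∀ a b as bs → a ∷ as ≤L b ∷ bs → a ≤o b
∷-≤L⇒≤o a b as bs p rewrite cmpL-∷ a b as bs with cmp a b | p
... | lt | _       = inj₁ refl
... | eq | _       = inj₂ refl
... | gt | inj₁ ()
... | gt | inj₂ ()

∷-<L-[]⇒<o : ∀ a e as → a ∷ as <L e ∷ [] → a <o e
∷-<L-[]⇒<o a e as p rewrite cmpL-∷ a e as [] with cmp a e | as | p
... | lt | _     | _ = refl
... | eq | []    | ()
... | eq | _ ∷ _ | ()
... | gt | _     | ()

≤o⇒[]-≤L : ∀ a b → a ≤o b → a ∷ [] ≤L b ∷ []
≤o⇒[]-≤L a b (inj₁ p) = inj₁ (∷-<L a b [] [] p)
≤o⇒[]-≤L a b (inj₂ p) rewrite cmp≡eq⇒≡ a b p = ≤o-refl (node (b ∷ []))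

-- Cantor normal forms, values and norms
_≮head_ : Tree → List Tree → Set
a ≮head []      = ⊤
a ≮head (b ∷ _) = ¬ (a <o b)

mutual
  IsCNF : Tree → Set
  IsCNF (node as) = IsCNFL as

  IsCNFL : List Tree → Set
  IsCNFL []       = ⊤
  IsCNFL (a ∷ as) = IsCNF a × IsCNFL as × a ≮head as

ωplus-cases : ∀ z L →
  (Σ[ h ∈ Tree ] Σ[ H ∈ List Tree ] L ≡ h ∷ H × z <o h × ωplus z L ≡ L)
  ⊎ (z ≮head L × ωplus z L ≡ z ∷ L)
ωplus-cases z []       = inj₂ (tt , refl)
ωplus-cases z (b ∷ bs) with cmp z b in q
... | lt = inj₁ (b , bs , refl , q , refl)
... | eq = inj₂ ((λ ()) , refl)
... | gt = inj₂ ((λ ()) , refl)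

ωplus-IsCNF : ∀ z L → IsCNF z → IsCNFL L → IsCNFL (ωplus z L)
ωplus-IsCNF z L cz cL with ωplus-cases z L
... | inj₁ (_ , _ , _ , _ , absorbed) rewrite absorbed = cL
... | inj₂ (z≮L , prepended) rewrite prepended = cz , cL , z≮L

mutual
  o-IsCNF : ∀ t → IsCNF (o t)
  o-IsCNF (node ts) = oL-IsCNFL ts

  oL-IsCNFL : ∀ ts → IsCNFL (oL ts)
  oL-IsCNFL []       = tt
  oL-IsCNFL (t ∷ ts) = ωplus-IsCNF (o t) (oL ts) (o-IsCNF t) (oL-IsCNFL ts)

ωplus-NoL : ∀ z L → NoL (ωplus z L) ≤ suc (No z) + NoL L
ωplus-NoL z L with ωplus-cases z L
... | inj₁ (_ , _ , _ , _ , absorbed) rewrite absorbed = m≤n+m (NoL L) (suc (No z))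
... | inj₂ (_ , prepended) rewrite prepended = ≤-refl

mutual
  No-o : ∀ t → No (o t) ≤ Nt t
  No-o (node ts) = NoL-oL ts

  NoL-oL : ∀ ts → NoL (oL ts) ≤ NtL ts
  NoL-oL []       = z≤n
  NoL-oL (t ∷ ts) = ≤-trans (ωplus-NoL (o t) (oL ts)) (s≤s (+-mono-≤ (No-o t) (NoL-oL ts)))

NoL-++ : ∀ as bs → NoL (as ++ bs) ≡ NoL as + NoL bs
NoL-++ []       bs = refl
NoL-++ (a ∷ as) bs rewrite NoL-++ as bs = cong suc (sym (+-assoc (No a) (NoL as) (NoL bs)))

ωplus-replicate : ∀ z x → ωplus z (replicate x z) ≡ z ∷ replicate x z
ωplus-replicate z zero    = refl
ωplus-replicate z (suc x) rewrite cmp-refl z = refl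

oL-replicate : ∀ z x → oL (replicate x z) ≡ replicate x (o z)
oL-replicate z zero    = refl
oL-replicate z (suc x) rewrite oL-replicate z x = ωplus-replicate (o z) x

ωplus-≢[] : ∀ z L → ωplus z L ≢ []
ωplus-≢[] z L with ωplus-cases z L
... | inj₁ (_ , _ , refl , _ , absorbed) rewrite absorbed = λ ()
... | inj₂ (_ , prepended) rewrite prepended = λ ()

oL-≢[] : ∀ w → w ≢ [] → oL w ≢ []
oL-≢[] []      w≢[] = ⊥-elim (w≢[] refl)
oL-≢[] (a ∷ w) _    = ωplus-≢[] (o a) (oL w)

-- The last summand
∷ʳ-≢[] : ∀ m (z : Tree) → m ∷ʳ z ≢ []
∷ʳ-≢[] m z p = case ++-conicalʳ m (z ∷ []) p of λ ()

isSucc-∷∷ : ∀ a b bs → isSucc (a ∷ b ∷ bs) ≡ isSucc (b ∷ bs)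
isSucc-∷∷ (node [])      b bs = refl
isSucc-∷∷ (node (_ ∷ _)) b bs = refl

isSucc-∷ʳ : ∀ P w → isSucc (P ∷ʳ w) ≡ isSucc (w ∷ [])
isSucc-∷ʳ []          w = refl
isSucc-∷ʳ (a ∷ [])    w = isSucc-∷∷ a w []
isSucc-∷ʳ (a ∷ b ∷ P) w = trans (isSucc-∷∷ a b (P ∷ʳ w)) (isSucc-∷ʳ (b ∷ P) w)

dropLast-∷ʳ : ∀ m z → dropLast (m ∷ʳ z) ≡ m
dropLast-∷ʳ []          z = refl
dropLast-∷ʳ (a ∷ [])    z = refl
dropLast-∷ʳ (a ∷ b ∷ m) z = cong (a ∷_) (dropLast-∷ʳ (b ∷ m) z)

fsL-∷ʳ : ∀ l s x → fsL (l ∷ʳ s) x ≡ l ++ fsLast s x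
fsL-∷ʳ []          s x = refl
fsL-∷ʳ (a ∷ [])    s x = refl
fsL-∷ʳ (a ∷ b ∷ l) s x = cong (a ∷_) (fsL-∷ʳ (b ∷ l) s x)

fsLast-succ : ∀ m y → fsLast (node (m ∷ʳ 𝟘)) y ≡ replicate y (node m)
fsLast-succ []      y = refl
fsLast-succ (c ∷ m) y rewrite isSucc-∷ʳ (c ∷ m) 𝟘 | dropLast-∷ʳ (c ∷ m) 𝟘 = refl

fsLast-limit : ∀ w y → w ≢ [] → isSucc w ≡ false → fsLast (node w) y ≡ node w [ y ] ∷ []
fsLast-limit []       y w≢[] _ = ⊥-elim (w≢[] refl)
fsLast-limit (c ∷ cs) y _ lim rewrite lim = refl

firstOr : Tree → List Tree → Tree
firstOr e []      = e
firstOr e (p ∷ _) = p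

ωplusWith : Cmp → Tree → List Tree → List Tree
ωplusWith lt z P = P
ωplusWith eq z P = z ∷ P
ωplusWith gt z P = z ∷ P

ωplus-∷ʳ : ∀ z e P → ωplus z (P ∷ʳ e) ≡ ωplusWith (cmp z (firstOr e P)) z P ∷ʳ e
ωplus-∷ʳ z e []      with cmp z e
... | lt = refl
... | eq = refl
... | gt = refl
ωplus-∷ʳ z e (p ∷ P) with cmp z p
... | lt = refl
... | eq = refl
... | gt = refl

oPrefix : Tree → List Tree → List Tree
oPrefix e []      = []
oPrefix e (a ∷ l) = ωplusWith (cmp (o a) (firstOr e (oPrefix e l))) (o a) (oPrefix e l)

oL-∷ʳ : ∀ l s → oL (l ∷ʳ s) ≡ oPrefix (o s) l ∷ʳ o s
oL-∷ʳ []      s = refl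
oL-∷ʳ (a ∷ l) s rewrite oL-∷ʳ l s = ωplus-∷ʳ (o a) (o s) (oPrefix (o s) l)

ωplus-∷ʳ-𝟘 : ∀ z L → ωplus z (L ∷ʳ 𝟘) ≡ ωplus z L ∷ʳ 𝟘
ωplus-∷ʳ-𝟘 (node [])      []       = refl
ωplus-∷ʳ-𝟘 (node (_ ∷ _)) []       = refl
ωplus-∷ʳ-𝟘 z              (b ∷ bs) with cmp z b
... | lt = refl
... | eq = refl
... | gt = refl

oL-∷ʳ-𝟘 : ∀ m → oL (m ∷ʳ 𝟘) ≡ oL m ∷ʳ 𝟘
oL-∷ʳ-𝟘 []      = refl
oL-∷ʳ-𝟘 (a ∷ m) rewrite oL-∷ʳ-𝟘 m = ωplus-∷ʳ-𝟘 (o a) (oL m)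

isSucc-[o] : ∀ z → isSucc (o z ∷ []) ≡ isSucc (z ∷ [])
isSucc-[o] (node [])       = refl
isSucc-[o] (node (c ∷ cs)) with ωplus (o c) (oL cs) | ωplus-≢[] (o c) (oL cs)
... | []    | ≢[] = ⊥-elim (≢[] refl)
... | _ ∷ _ | _   = refl

isSucc-oL : ∀ l → isSucc (oL l) ≡ isSucc l
isSucc-oL l with initLast l
... | []       = refl
... | m ∷ʳ′ z
  rewrite oL-∷ʳ m z | isSucc-∷ʳ (oPrefix (o z) m) (o z) | isSucc-∷ʳ m z = isSucc-[o] z

-- Monotonicity of fundamental sequences and the Bachmann property
infix 4 _⊑_
_⊑_ : List Tree → List Tree → Set
as ⊑ bs = as ≤L bs × NoL as ≤ NoL bs

replicate-⊑ : ∀ d {y y'} → y ≤ y' → replicate y d ⊑ replicate y' d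
replicate-⊑ d {zero}  {zero}   _         = ≤o-refl 𝟘 , z≤n
replicate-⊑ d {zero}  {suc y'} _         = inj₁ refl , z≤n
replicate-⊑ d {suc y} {suc y'} (s≤s y≤y') =
  ∷-≤L d _ _ (proj₁ IH) , s≤s (+-monoʳ-≤ (No d) (proj₂ IH))
  where IH = replicate-⊑ d y≤y'

mutual
  fsLast-mono : ∀ s {y y'} → y ≤ y' → fsLast s y ⊑ fsLast s y'
  fsLast-mono (node [])       _    = ≤o-refl 𝟘 , z≤n
  fsLast-mono (node (c ∷ cs)) {y} {y'} y≤y' with isSucc (c ∷ cs) | fsL-mono (c ∷ cs) y≤y'
  ... | true  | _         = replicate-⊑ _ y≤y'
  ... | false | ord , nrm =
    ≤o⇒[]-≤L (node (fsL (c ∷ cs) y)) (node (fsL (c ∷ cs) y')) ord , s≤s (+-monoˡ-≤ 0 nrm)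

  fsL-mono : ∀ l {y y'} → y ≤ y' → fsL l y ⊑ fsL l y'
  fsL-mono []           _    = ≤o-refl 𝟘 , z≤n
  fsL-mono (m ∷ [])     y≤y' = fsLast-mono m y≤y'
  fsL-mono (m ∷ m' ∷ ms) y≤y' with fsL-mono (m' ∷ ms) y≤y'
  ... | ord , nrm = ∷-≤L m _ _ ord , s≤s (+-monoʳ-≤ (No m) nrm)

dropLast-<L : ∀ c cs → dropLast (c ∷ cs) <L c ∷ cs
dropLast-<L c []       = refl
dropLast-<L c (d ∷ ds) rewrite cmpL-∷-same c (dropLast (d ∷ ds)) (d ∷ ds) = dropLast-<L d ds

mutual
  fsLast-<L : ∀ m y → fsLast m y <L m ∷ []
  fsLast-<L (node [])       y = refl
  fsLast-<L (node (c ∷ cs)) y with isSucc (c ∷ cs)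
  ... | true  = replicate-<L y
    where
      replicate-<L : ∀ y → replicate y (node (dropLast (c ∷ cs))) <L node (c ∷ cs) ∷ []
      replicate-<L zero    = refl
      replicate-<L (suc y) = ∷-<L (node (dropLast (c ∷ cs))) (node (c ∷ cs)) _ [] (dropLast-<L c cs)
  ... | false = ∷-<L (node (fsL (c ∷ cs) y)) (node (c ∷ cs)) [] [] (fsL-<L c cs y)

  fsL-<L : ∀ m ms y → fsL (m ∷ ms) y <L m ∷ ms
  fsL-<L m []        y = fsLast-<L m y
  fsL-<L m (m' ∷ ms) y rewrite cmpL-∷-same m (fsL (m' ∷ ms) y) (m' ∷ ms) = fsL-<L m' ms y

≤L-fsLast⇒<o : ∀ e y h H → h ∷ H ≤L fsLast e y → h <o e
≤L-fsLast⇒<o e y h H p =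
  ∷-<L-[]⇒<o h e H
    (≤o-<o-trans (node (h ∷ H)) (node (fsLast e y)) (node (e ∷ [])) p (fsLast-<L e y))

<L-succ⇒≤L-dropLast : ∀ l βs → isSucc l ≡ true → βs <L l → βs ≤L dropLast l
<L-succ⇒≤L-dropLast (node [] ∷ [])      []                   _ _  = inj₂ refl
<L-succ⇒≤L-dropLast (node [] ∷ [])      (node [] ∷ [])       _ ()
<L-succ⇒≤L-dropLast (node [] ∷ [])      (node [] ∷ _ ∷ _)    _ ()
<L-succ⇒≤L-dropLast (node [] ∷ [])      (node (_ ∷ _) ∷ _)   _ ()
<L-succ⇒≤L-dropLast (a ∷ b ∷ bs)        []                   _ _  = inj₁ refl
<L-succ⇒≤L-dropLast (a ∷ b ∷ bs)        (β ∷ βs) succ p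
  rewrite cmpL-∷ β a βs (b ∷ bs) | cmpL-∷ β a βs (dropLast (b ∷ bs)) with cmp β a
... | lt = inj₁ refl
... | eq = <L-succ⇒≤L-dropLast (b ∷ bs) βs (trans (sym (isSucc-∷∷ a b bs)) succ) p
<L-succ⇒≤L-dropLast (a ∷ b ∷ bs)        (β ∷ βs) succ () | gt

<L-replicate : ∀ βs d k → d ≮head βs → IsCNFL βs → NoL βs < k → βs <L replicate k d
<L-replicate []       d (suc k) _   _                  _         = refl
<L-replicate (β ∷ βs) d (suc k) β≮d (_ , cβs , βs≮β) (s≤s N<k)
  rewrite cmpL-∷ β d βs (replicate k d) with cmp β d in q
... | lt = refl
... | eq rewrite cmp≡eq⇒≡ β d q =
  <L-replicate βs d k βs≮β cβs (≤-trans (s≤s (m≤n+m (NoL βs) (No d))) N<k)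
... | gt = ⊥-elim (β≮d (cmp≡gt⇒>o β d q))

bachmann : ∀ λs βs y → isSucc λs ≡ false → λs ≢ [] → IsCNFL βs → βs <L λs → NoL βs < y →
           βs <L fsL λs y
bachmann []                    βs y _   λs≢[] _ _ _ = ⊥-elim (λs≢[] refl)
bachmann (node [] ∷ [])        βs y ()  _     _ _ _
bachmann (node (c ∷ cs) ∷ [])  βs y lim _     cβs p N<y with isSucc (c ∷ cs) in succ
bachmann (node (c ∷ cs) ∷ [])  []             (suc y) _ _ _ _ _ | true = refl
bachmann (node (c ∷ cs) ∷ [])  (node νs ∷ βs) (suc y) _ _ (_ , cβs , βs≮ν) p (s≤s N<y) | true
  with <L-succ⇒≤L-dropLast (c ∷ cs) νs succ (∷-<L-[]⇒<o (node νs) _ βs p)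
... | inj₁ ν<δ = ∷-<L (node νs) _ βs _ ν<δ
... | inj₂ ν≡δ with cmpL≡eq⇒≡ νs _ ν≡δ
... | refl rewrite cmpL-∷-same (node νs) βs (replicate y (node νs)) =
  <L-replicate βs (node νs) y βs≮ν cβs (≤-trans (s≤s (m≤n+m (NoL βs) (NoL νs))) N<y)
bachmann (node (c ∷ cs) ∷ [])  []             y _ _ _ _ _ | false = refl
bachmann (node (c ∷ cs) ∷ [])  (node νs ∷ βs) y _ _ (cν , _ , _) p N<y | false =
  ∷-<L (node νs) _ βs []
    (bachmann (c ∷ cs) νs y succ (λ ()) cν (∷-<L-[]⇒<o (node νs) _ βs p)
      (≤-trans (s≤s (m≤m+n (NoL νs) (NoL βs))) (≤-trans (n≤1+n _) N<y)))
bachmann (μ ∷ μ' ∷ μs)         []       y _ _ _ _ _ = refl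
bachmann (μ ∷ μ' ∷ μs)         (β ∷ βs) y lim _ (_ , cβs , _) p N<y
  rewrite cmpL-∷ β μ βs (μ' ∷ μs) | cmpL-∷ β μ βs (fsL (μ' ∷ μs) y) with cmp β μ
... | lt = refl
... | eq = bachmann (μ' ∷ μs) βs y (trans (sym (isSucc-∷∷ μ μ' μs)) lim) (λ ()) cβs p
             (≤-trans (s≤s (m≤n+m (NoL βs) (No β))) (≤-trans (n≤1+n _) N<y))
bachmann (μ ∷ μ' ∷ μs)         (β ∷ βs) y lim _ _ () _ | gt

∷-≤L-fsLast : ∀ e z F {y y'} → IsCNF z → z <o e → No z < y → y' < y →
              F ≤L fsLast e y' → z ∷ F ≤L fsLast e y
∷-≤L-fsLast (node [])       (node [])      F _ () _ _ _
∷-≤L-fsLast (node [])       (node (_ ∷ _)) F _ () _ _ _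
∷-≤L-fsLast (node (c ∷ cs)) (node zs) F cz z<e N<y y'<y F≤ with isSucc (c ∷ cs) in succ
∷-≤L-fsLast (node (c ∷ cs)) (node zs) F {suc y} cz z<e N<y (s≤s y'≤y) F≤ | true
  with <L-succ⇒≤L-dropLast (c ∷ cs) zs succ z<e
... | inj₁ z<δ = inj₁ (∷-<L (node zs) _ F _ z<δ)
... | inj₂ z≡δ with cmpL≡eq⇒≡ zs _ z≡δ
... | refl = ∷-≤L (node zs) F _
               (≤o-trans (node F) _ _ F≤ (proj₁ (replicate-⊑ (node zs) y'≤y)))
∷-≤L-fsLast (node (c ∷ cs)) (node zs) F {y} cz z<e N<y _ _ | false =
  inj₁ (∷-<L (node zs) _ F [] (bachmann (c ∷ cs) zs y succ (λ ()) cz z<e N<y))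

≤L-++-fsLast⇒≤o-firstOr : ∀ e y h H P → h ∷ H ≤L P ++ fsLast e y → h ≤o firstOr e P
≤L-++-fsLast⇒≤o-firstOr e y h H []      p = inj₁ (≤L-fsLast⇒<o e y h H p)
≤L-++-fsLast⇒≤o-firstOr e y h H (q ∷ P) p = ∷-≤L⇒≤o h q H _ p

NoL-++-fsLast-mono : ∀ P e {y' y} → y' ≤ y → NoL (P ++ fsLast e y') ≤ NoL (P ++ fsLast e y)
NoL-++-fsLast-mono P e {y'} {y} y'≤y
  rewrite NoL-++ P (fsLast e y') | NoL-++ P (fsLast e y) =
  +-monoʳ-≤ (NoL P) (proj₂ (fsLast-mono e y'≤y))

-- Induction on the summands
infix 4 _≼⟨_⟩_
_≼⟨_⟩_ : List Tree → ℕ → List Tree → Set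
A ≼⟨ y ⟩ B = NoL A ≤ NoL B + (y ∸ 2) × A ≤L B

⊑⇒≼ : ∀ A B y → A ⊑ B → A ≼⟨ y ⟩ B
⊑⇒≼ A B y (A≤B , NA≤NB) = ≤-trans NA≤NB (m≤m+n (NoL B) (y ∸ 2)) , A≤B

≼-weaken : ∀ A B' B {y' y} → A ≼⟨ y' ⟩ B' → B' ⊑ B → y' ≤ y → A ≼⟨ y ⟩ B
≼-weaken A B' B (NA≤ , A≤B') (B'≤B , NB'≤NB) y'≤y =
  ≤-trans NA≤ (+-mono-≤ NB'≤NB (∸-monoˡ-≤ 2 y'≤y)) , ≤o-trans (node A) (node B') (node B) A≤B' B'≤B

∷-≼ : ∀ z A B y → A ≼⟨ y ⟩ B → z ∷ A ≼⟨ y ⟩ z ∷ B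
∷-≼ z A B y (NA≤ , A≤B) =
  s≤s (≤-trans (+-monoʳ-≤ (No z) NA≤) (≤-reflexive (sym (+-assoc (No z) (NoL B) (y ∸ 2))))) ,
  ∷-≤L z A B A≤B

[]-≼ : ∀ A B y → A ≼⟨ y ⟩ B → node A ∷ [] ≼⟨ y ⟩ node B ∷ []
[]-≼ A B y (NA≤ , A≤B) rewrite +-identityʳ (NoL A) | +-identityʳ (NoL B) =
  s≤s NA≤ , ≤o⇒[]-≤L (node A) (node B) A≤B

ωplus-≼-kept : ∀ e z A P y → ¬ (z <o firstOr e P) → A ≼⟨ y ⟩ P ++ fsLast e y →
               ωplus z A ≼⟨ y ⟩ z ∷ P ++ fsLast e y
ωplus-≼-kept e z A P y z≮P A≼@(_ , A≤) with ωplus-cases z A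
... | inj₁ (h , H , refl , z<h , _) =
  ⊥-elim (z≮P (<o-≤o-trans z h (firstOr e P) z<h (≤L-++-fsLast⇒≤o-firstOr e y h H P A≤)))
... | inj₂ (_ , prepended) rewrite prepended = ∷-≼ z A (P ++ fsLast e y) y A≼

∷-≼-absorbed : ∀ e z F P {y' y} N → IsCNF z → No z ≤ N → 2 ≤ y' → y' + suc N ≤ y →
               z <o firstOr e P → F ≼⟨ y' ⟩ P ++ fsLast e y' → z ∷ F ≼⟨ y ⟩ P ++ fsLast e y
∷-≼-absorbed e z F P {y'} {y} N cz z≤N 2≤y' y'+N<y z<P (NF≤ , F≤) = norm , order P z<P F≤
  where
    y'≤y : y' ≤ y
    y'≤y = m+n≤o⇒m≤o y' y'+N<y

    order : ∀ P → z <o firstOr e P → F ≤L P ++ fsLast e y' → z ∷ F ≤L P ++ fsLast e y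
    order []      z<e F≤ = ∷-≤L-fsLast e z F cz z<e
      (≤-trans (s≤s z≤N) (m+n≤o⇒n≤o y' y'+N<y))
      (≤-trans (m<m+n y' z<s) y'+N<y) F≤
    order (p ∷ P) z<p _  = inj₁ (∷-<L z p F _ z<p)

    shuffle : ∀ n q d → suc (n + (q + d)) ≡ q + (d + suc n)
    shuffle = solve-∀

    Q' = NoL (P ++ fsLast e y')
    open ≤-Reasoning
    norm : NoL (z ∷ F) ≤ NoL (P ++ fsLast e y) + (y ∸ 2)
    norm = begin
      suc (No z + NoL F)           ≤⟨ s≤s (+-mono-≤ z≤N NF≤) ⟩
      suc (N + (Q' + (y' ∸ 2)))    ≡⟨ shuffle N Q' (y' ∸ 2) ⟩
      Q' + (y' ∸ 2 + suc N)        ≡⟨ cong (Q' +_) (sym (+-∸-comm (suc N) 2≤y')) ⟩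
      Q' + (y' + suc N ∸ 2)        ≤⟨ +-mono-≤ (NoL-++-fsLast-mono P e y'≤y) (∸-monoˡ-≤ 2 y'+N<y) ⟩
      NoL (P ++ fsLast e y) + (y ∸ 2) ∎

<t⇒<t?≡true : ∀ t s → t <t s → (t <t? s) ≡ true
<t⇒<t?≡true t s p rewrite p = refl

absorbed⇒anyGreater : ∀ a s l → o a <o firstOr (o s) (oPrefix (o s) l) →
                      anyGreater a (l ∷ʳ s) ≡ true
absorbed⇒anyGreater a s []      p rewrite <t⇒<t?≡true a s p = refl
absorbed⇒anyGreater a s (b ∷ l) p with cmp (o b) (firstOr (o s) (oPrefix (o s) l))
... | lt rewrite absorbed⇒anyGreater a s l p = ∨-zeroʳ (a <t? b)
... | eq rewrite <t⇒<t?≡true a b p = refl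
... | gt rewrite <t⇒<t?≡true a b p = refl

ωplusWith-cases : ∀ c z P → (c ≡ lt × ωplusWith c z P ≡ P) ⊎ (c ≢ lt × ωplusWith c z P ≡ z ∷ P)
ωplusWith-cases lt z P = inj₁ (refl , refl)
ωplusWith-cases eq z P = inj₂ ((λ ()) , refl)
ωplusWith-cases gt z P = inj₂ ((λ ()) , refl)

prefix-≼-∷ : ∀ s R b a l → 2 ≤ b →
  (∀ y → b + crSum (l ∷ʳ s) ≤ y → oL (l ++ R) ≼⟨ y ⟩ oPrefix (o s) l ++ fsLast (o s) y) →
  ∀ y → b + crSum ((a ∷ l) ∷ʳ s) ≤ y →
  oL ((a ∷ l) ++ R) ≼⟨ y ⟩ oPrefix (o s) (a ∷ l) ++ fsLast (o s) y
prefix-≼-∷ s R b a l 2≤b IH y hy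
  with ωplusWith-cases (cmp (o a) (firstOr (o s) (oPrefix (o s) l))) (o a) (oPrefix (o s) l)
     | IH y (≤-trans (+-monoʳ-≤ b (m≤n+m _ _)) hy)
... | inj₂ (a≮P , kept) | IH-y rewrite kept =
  ωplus-≼-kept (o s) (o a) (oL (l ++ R)) (oPrefix (o s) l) y a≮P IH-y
... | inj₁ (a<P , absorbed) | IH-y rewrite absorbed with ωplus-cases (o a) (oL (l ++ R))
...   | inj₁ (_ , _ , _ , _ , absorbed-too) rewrite absorbed-too = IH-y
...   | inj₂ (_ , prepended) rewrite prepended =
  ∷-≼-absorbed (o s) (o a) (oL (l ++ R)) (oPrefix (o s) l) (Nt a + 0)
    (o-IsCNF a) (≤-trans (No-o a) (m≤m+n (Nt a) 0)) 2≤y' (≤-reflexive (m∸n+n≡m k≤y)) a<P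
    (IH (y ∸ k) b+C≤y')
  where
    C = crSum (l ∷ʳ s)
    k = NωT a
    -- a is absorbed in o(t) by a later summand, so Cr t pays k = N(ω^a) = 1 + N a for it
    b+k+C≤y : b + (k + C) ≤ y
    b+k+C≤y =
      subst (λ g → b + ((if g then k else 0) + C) ≤ y) (absorbed⇒anyGreater a s l a<P) hy
    k≤y : k ≤ y
    k≤y = m+n≤o⇒n≤o b (≤-trans (+-monoʳ-≤ b (m≤m+n k C)) b+k+C≤y)
    b+C≤y' : b + C ≤ y ∸ k
    b+C≤y' = m+n≤o⇒m≤o∸n (b + C)
      (subst (_≤ y) (trans (cong (b +_) (+-comm k C)) (sym (+-assoc b C k))) b+k+C≤y)
    2≤y' : 2 ≤ y ∸ k
    2≤y' = ≤-trans 2≤b (m+n≤o⇒m≤o b b+C≤y')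

prefix-≼ : ∀ s R b → 2 ≤ b → (∀ y → b ≤ y → oL R ≼⟨ y ⟩ fsLast (o s) y) →
           ∀ l y → b + crSum (l ∷ʳ s) ≤ y →
           oL (l ++ R) ≼⟨ y ⟩ oPrefix (o s) l ++ fsLast (o s) y
prefix-≼ s R b 2≤b base []      y hy = base y (≤-trans (m≤m+n b 0) hy)
prefix-≼ s R b 2≤b base (a ∷ l)      = prefix-≼-∷ s R b a l 2≤b (prefix-≼ s R b 2≤b base l)

-- For t = node ts this is definitionally
-- ∀ x → 2 ≤ x → oL (fsL ts x) ≼⟨ x + Cr t ⟩ fsL (oL ts) (x + Cr t).
FsBound : Tree → Set
FsBound t = (x : ℕ) → 2 ≤ x →
    (No (o (t [ x ])) ≤ No ((o t) [ x + Cr t ]o) + (x + Cr t ∸ 2))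
    × (o (t [ x ]) ≤o (o t) [ x + Cr t ]o)

fsLast-≼-succ : ∀ m x y → x ≤ y →
                oL (fsLast (node (m ∷ʳ 𝟘)) x) ≼⟨ y ⟩ fsLast (o (node (m ∷ʳ 𝟘))) y
fsLast-≼-succ m x y x≤y
  rewrite fsLast-succ m x | oL-replicate (node m) x | oL-∷ʳ-𝟘 m | fsLast-succ (oL m) y =
  ⊑⇒≼ (replicate x δ) (replicate y δ) y (replicate-⊑ δ x≤y)
  where δ = node (oL m)

fsLast-≼-limit : ∀ λs x y → λs ≢ [] → isSucc λs ≡ false → FsBound (node λs) → 2 ≤ x →
                 x + Cr (node λs) ≤ y → oL (fsLast (node λs) x) ≼⟨ y ⟩ fsLast (o (node λs)) y
fsLast-≼-limit λs x y λs≢[] lim IH 2≤x x+Cr≤y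
  rewrite fsLast-limit λs x λs≢[] lim
        | fsLast-limit (oL λs) y (oL-≢[] λs λs≢[]) (trans (isSucc-oL λs) lim) =
  []-≼ (oL (fsL λs x)) (fsL (oL λs) y) y
    (≼-weaken (oL (fsL λs x)) (fsL (oL λs) (x + Cr (node λs))) (fsL (oL λs) y)
      (IH x 2≤x) (fsL-mono (oL λs) x+Cr≤y) x+Cr≤y)

fsLast-≼ : ∀ s x y → FsBound s → 2 ≤ x → x + Cr s ≤ y → oL (fsLast s x) ≼⟨ y ⟩ fsLast (o s) y
fsLast-≼ (node w) x y IH 2≤x x+Cr≤y with initLast w
... | []                = z≤n , ≤o-refl 𝟘
... | m ∷ʳ′ node []     = fsLast-≼-succ m x y (m+n≤o⇒m≤o x x+Cr≤y)
... | m ∷ʳ′ node (c ∷ cs) =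
  fsLast-≼-limit (m ∷ʳ node (c ∷ cs)) x y (∷ʳ-≢[] m _) (isSucc-∷ʳ m (node (c ∷ cs)))
    IH 2≤x x+Cr≤y

Cr≤crMax-∷ʳ : ∀ l s → Cr s ≤ crMax (l ∷ʳ s)
Cr≤crMax-∷ʳ []      s = m≤m⊔n (Cr s) 0
Cr≤crMax-∷ʳ (b ∷ l) s = ≤-trans (Cr≤crMax-∷ʳ l s) (m≤n⊔m (Cr b) _)

fsBound-∷ʳ : ∀ l s → FsBound s → FsBound (node (l ∷ʳ s))
fsBound-∷ʳ l s IH x 2≤x
  rewrite fsL-∷ʳ l s x | oL-∷ʳ l s | fsL-∷ʳ (oPrefix (o s) l) (o s) (x + Cr (node (l ∷ʳ s))) =
  prefix-≼ s (fsLast s x) (x + Cr s) (≤-trans 2≤x (m≤m+n x (Cr s)))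
    (λ y → fsLast-≼ s x y IH 2≤x) l (x + (C + crMax (l ∷ʳ s))) x+Cr+C≤x+Cr
  where
    C = crSum (l ∷ʳ s)
    x+Cr+C≤x+Cr : x + Cr s + C ≤ x + (C + crMax (l ∷ʳ s))
    x+Cr+C≤x+Cr rewrite +-assoc x (Cr s) C | +-comm (Cr s) C =
      +-monoʳ-≤ x (+-monoʳ-≤ C (Cr≤crMax-∷ʳ l s))

mutual
  lemma21 : (t : Tree) (x : ℕ) → 2 ≤ x →
    (No (o (t [ x ])) ≤ No ((o t) [ x + Cr t ]o) + (x + Cr t ∸ 2))
    × (o (t [ x ]) ≤o (o t) [ x + Cr t ]o)
  lemma21 (node ts) with initLast ts | fsBound-all ts
  ... | []      | _  = λ _ _ → z≤n , ≤o-refl 𝟘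
  ... | l ∷ʳ′ s | IH = fsBound-∷ʳ l s (head (++⁻ʳ l IH))

  fsBound-all : ∀ ts → All FsBound ts
  fsBound-all []       = []
  fsBound-all (t ∷ ts) = lemma21 t ∷ fsBound-all ts
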